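{- Let $m,p,\ell$ be positive integers. If $t$ is an edge labeling of $K_n$ of $(m,\ell)_p$ type, then for any two distinct vertices $u,v$ and any $p$-swap $\theta$ of $t$, $$|s(\theta t,u)-s(\theta t,v)|\le |s(t,u)-s(t,v)|+2mp^2+2p(n-\ell-1).$$
   Context: $K_n$ is the complete graph on $n$ vertices with edge set $E$, $\epsilon=\binom n2$, $[a]=\{1,\dots,a\}$; a 1-AP is a set of consecutive integers. $D(v)$ is the set of edges containing vertex $v$. An edge labeling is a bijection $t:E\to[\epsilon]$; $S(t,v)=\{t(e):e\in D(v)\}$, $s(t,v)=\sum_{e\in D(v)}t(e)$. A $p$-swap of $t$ is a map $\theta$ sending $t$ to another edge labeling $\theta t$ with $|t(e)-\theta t(e)|\le p$ for all $e$. $S(t,v)$ is of $(m,\ell)_p$ type if there exist at most $m$ pairwise disjoint 1-APs contained in $S(t,v)$, each of length at least $2p$, whose lengths sum to at least $\ell$; $t$ is of $(m,\ell)_p$ type if $S(t,v)$ is of $(m,\ell)_p$ type for every vertex $v$. -}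

module Defs where

open import Data.Nat using (ℕ; zero; suc; _+_; _*_; _∸_; _≤_; _<_; ∣_-_∣)
open import Data.Fin using (Fin; toℕ)
import Data.Fin as F
open import Data.Fin.Properties using (<-cmp)
open import Data.Product using (Σ; ∃; _×_; _,_; proj₁; proj₂)
open import Data.List using (List; length; map; allFin)
open import Data.Nat.ListAction using (sum)
open import Data.Nat.DivMod using (_/_)
open import Data.List.Relation.Unary.All using (All)
open import Data.List.Relation.Unary.AllPairs using (AllPairs)
open import Data.Sum using (_⊎_)
open import Function.Bundles using (_⤖_; Bijection)
open import Relation.Binary.PropositionalEquality using (_≡_)
open import Relation.Binary.Definitions using (tri<; tri≈; tri>)

-- Edges of K_n: unordered pairs {i,j}, i ≠ j, represented as (i , j) with i < j.
Edge : ℕ → Set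
Edge n = Σ (Fin n × Fin n) (λ ij → proj₁ ij F.< proj₂ ij)

ε : ℕ → ℕ
ε n = (n * (n ∸ 1)) / 2

-- an edge labeling: a bijection E → [ε] (Fin (ε n) ≅ {1..ε} via k ↦ toℕ k + 1)
Labeling : ℕ → Set
Labeling n = Edge n ⤖ Fin (ε n)

label : ∀ {n} → Labeling n → Edge n → ℕ
label t e = suc (toℕ (Bijection.to t e))

-- the label of the edge {v,w} of D(v) (0 when w = v, i.e. no edge)
labAt : ∀ {n} → Labeling n → Fin n → Fin n → ℕ
labAt {n} t v w with <-cmp v w
... | tri< v<w _ _ = label t ((v , w) , v<w)
... | tri≈ _ _ _   = 0
... | tri> _ _ w<v = label t ((w , v) , w<v)

s : ∀ {n} → Labeling n → Fin n → ℕ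
s {n} t v = sum (map (labAt t v) (allFin n))

InS : ∀ {n} → Labeling n → Fin n → ℕ → Set
InS {n} t v x = ∃ λ (e : Edge n) → (proj₁ (proj₁ e) ≡ v ⊎ proj₂ (proj₁ e) ≡ v) × label t e ≡ x

IsPSwap : ∀ {n} → ℕ → Labeling n → Labeling n → Set
IsPSwap {n} p t t' = ∀ (e : Edge n) → ∣ label t e - label t' e ∣ ≤ p

-- a 1-AP given by (a , k) is {a, a+1, ..., a+k-1}
AP : Set
AP = ℕ × ℕ

apLen : AP → ℕ
apLen = proj₂

APContained : ∀ {n} → Labeling n → Fin n → AP → Set
APContained t v (a , k) = ∀ i → i < k → InS t v (a + i)

Disjoint : AP → AP → Set
Disjoint (a , k) (b , j) = (a + k ≤ b) ⊎ (b + j ≤ a)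

STypeAt : ∀ {n} → ℕ → ℕ → ℕ → Labeling n → Fin n → Set
STypeAt m ℓ p t v = ∃ λ (as : List AP) →
    length as ≤ m
  × AllPairs Disjoint as
  × All (λ A → APContained t v A × 2 * p ≤ apLen A) as
  × ℓ ≤ sum (map apLen as)

OfType : ∀ {n} → ℕ → ℕ → ℕ → Labeling n → Set
OfType {n} m ℓ p t = ∀ (v : Fin n) → STypeAt m ℓ p t v

-- Let N = ε n and let π be the permutation of the labels [1, N] that sends the t-label of each
-- edge to its θt-label; it moves every label by at most p. For an interval I ⊆ [1, N] the sums
-- ∑_{y ∈ I} π y and ∑_{y ∈ I} y differ by at most p²: write both as ∑_c #{y ∈ I | c < y}
-- (layer cake). Since π permutes [1, N], the number of labels above c is unchanged, and only
-- labels within distance p of c can cross it; so the two counts for I differ by at most p minus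
-- the distance from c to the relevant end of I (the tent function), and these bounds add up to
-- p² over all c. At a vertex u the labels split into the at most m APs of its (m, ℓ)_p type,
-- costing at most p² each, and at most n − 1 − ℓ further labels, each moving by at most p. So
-- s(θt, u) and s(t, u) differ by at most m p² + p (n − 1 − ℓ), and the triangle inequality
-- through u and v gives the theorem.

module Submission where

open import Data.Fin using (Fin; toℕ; fromℕ<)
import Data.Fin.Properties as Finₚ
open Finₚ using (toℕ<n; toℕ-injective; toℕ-fromℕ<)
open import Data.List using (List; []; _∷_; map; length; allFin)
open import Data.List.Membership.Propositional using (_∈_)
open import Data.List.Membership.Propositional.Properties using (∈-allFin)
open import Data.List.Properties using (map-cong; length-tabulate)
open import Data.List.Relation.Unary.All using (All; []; _∷_)
import Data.List.Relation.Unary.All as All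
open import Data.List.Relation.Unary.AllPairs using (AllPairs; []; _∷_)
open import Data.List.Relation.Unary.Any using (here; there)
open import Data.Nat hiding (_+_; _*_)
import Data.Nat as ℕ
open import Data.Nat.ListAction using (sum)
open import Data.Nat.Properties
open import Algebra.Properties.CommutativeSemigroup +-commutativeSemigroup
  using () renaming (interchange to +-interchange)
open import Data.Product using (∃; _×_; _,_; proj₁; proj₂)
open import Data.Sum using (inj₁; inj₂)
open import Defs
open import Function using (_∘_; id)
open import Function.Bundles using (Bijection)
open import Relation.Binary.Definitions using (tri<; tri≈; tri>)
open import Relation.Binary.PropositionalEquality
  using (_≡_; _≢_; refl; sym; trans; cong; cong₂; subst; module ≡-Reasoning)
open import Relation.Nullary using (Dec; contradiction; yes; no)

-- ℕ's _+_ and _*_ are opened only inside this module: the theorem is stated with those of ℤ.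
module _ where

  open import Data.Nat using (_+_; _*_)

  m∸[n∸o]≤m+o∸n : ∀ m n o → m ∸ (n ∸ o) ≤ m + o ∸ n
  m∸[n∸o]≤m+o∸n m n       zero    = ≤-reflexive (cong (_∸ n) (sym (+-identityʳ m)))
  m∸[n∸o]≤m+o∸n m zero    (suc o) = m≤m+n m (suc o)
  m∸[n∸o]≤m+o∸n m (suc n) (suc o) =
    subst (λ q → m ∸ (n ∸ o) ≤ q ∸ suc n) (sym (+-suc m o)) (m∸[n∸o]≤m+o∸n m n o)

  ∣m-n∣≤o⇒m≤n+o : ∀ {m n o} → ∣ m - n ∣ ≤ o → m ≤ n + o
  ∣m-n∣≤o⇒m≤n+o {m} {n} le = ≤-trans (m≤n+∣m-n∣ m n) (+-monoʳ-≤ n le)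

  ∣m-n∣≤o⇒n≤m+o : ∀ {m n o} → ∣ m - n ∣ ≤ o → n ≤ m + o
  ∣m-n∣≤o⇒n≤m+o {m} {n} le = ∣m-n∣≤o⇒m≤n+o (subst (_≤ _) (∣-∣-comm m n) le)

  m≤n+o⇒n≤m+o⇒∣m-n∣≤o : ∀ {m n o} → m ≤ n + o → n ≤ m + o → ∣ m - n ∣ ≤ o
  m≤n+o⇒n≤m+o⇒∣m-n∣≤o {m} {n} m≤n+o n≤m+o with ∣m-n∣≡[m∸n]∨[n∸m] m n
  ... | inj₁ eq = subst (_≤ _) (sym eq) (m≤n+o⇒m∸n≤o m n m≤n+o)
  ... | inj₂ eq = subst (_≤ _) (sym eq) (m≤n+o⇒m∸n≤o n m n≤m+o)

  ∣-∣-drift : ∀ {m n m′ n′ d} → ∣ m′ - m ∣ ≤ d → ∣ n′ - n ∣ ≤ d →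
              ∣ m′ - n′ ∣ ≤ ∣ m - n ∣ + (d + d)
  ∣-∣-drift {m} {n} {m′} {n′} {d} m-drift n-drift = begin
    ∣ m′ - n′ ∣
      ≤⟨ ∣-∣-triangle m′ m n′ ⟩
    ∣ m′ - m ∣ + ∣ m - n′ ∣
      ≤⟨ +-monoʳ-≤ ∣ m′ - m ∣ (∣-∣-triangle m n n′) ⟩
    ∣ m′ - m ∣ + (∣ m - n ∣ + ∣ n - n′ ∣)
      ≤⟨ +-mono-≤ m-drift (+-monoʳ-≤ ∣ m - n ∣ (subst (_≤ d) (∣-∣-comm n′ n) n-drift)) ⟩
    d + (∣ m - n ∣ + d)
      ≡⟨ +-comm d _ ⟩
    (∣ m - n ∣ + d) + d
      ≡⟨ +-assoc ∣ m - n ∣ d d ⟩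
    ∣ m - n ∣ + (d + d) ∎
    where open ≤-Reasoning



  sumFrom : ℕ → ℕ → (ℕ → ℕ) → ℕ
  sumFrom a zero    f = 0
  sumFrom a (suc k) f = f a + sumFrom (suc a) k f

  private
    head-in-range : ∀ a k → a < a + suc k
    head-in-range a k = m<m+n a z<s

    tail-in-range : ∀ a k {i} → i < suc a + k → i < a + suc k
    tail-in-range a k {i} = subst (i <_) (sym (+-suc a k))

  sumFrom-cong : ∀ a k {f g : ℕ → ℕ} → (∀ i → a ≤ i → i < a + k → f i ≡ g i) →
                 sumFrom a k f ≡ sumFrom a k g
  sumFrom-cong a zero    eq = refl
  sumFrom-cong a (suc k) eq = cong₂ _+_ (eq a ≤-refl (head-in-range a k))
    (sumFrom-cong (suc a) k λ i a<i i<e → eq i (<⇒≤ a<i) (tail-in-range a k i<e))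

  sumFrom-mono : ∀ a k {f g : ℕ → ℕ} → (∀ i → a ≤ i → i < a + k → f i ≤ g i) →
                 sumFrom a k f ≤ sumFrom a k g
  sumFrom-mono a zero    le = z≤n
  sumFrom-mono a (suc k) le = +-mono-≤ (le a ≤-refl (head-in-range a k))
    (sumFrom-mono (suc a) k λ i a<i i<e → le i (<⇒≤ a<i) (tail-in-range a k i<e))

  sumFrom-zero : ∀ a k {f : ℕ → ℕ} → (∀ i → a ≤ i → i < a + k → f i ≡ 0) → sumFrom a k f ≡ 0
  sumFrom-zero a zero    eq = refl
  sumFrom-zero a (suc k) eq = cong₂ _+_ (eq a ≤-refl (head-in-range a k))
    (sumFrom-zero (suc a) k λ i a<i i<e → eq i (<⇒≤ a<i) (tail-in-range a k i<e))

  sumFrom-const : ∀ a k c → sumFrom a k (λ _ → c) ≡ k * c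
  sumFrom-const a zero    c = refl
  sumFrom-const a (suc k) c = cong (c +_) (sumFrom-const (suc a) k c)

  sumFrom-distrib-+ : ∀ a k (f g : ℕ → ℕ) →
                      sumFrom a k (λ i → f i + g i) ≡ sumFrom a k f + sumFrom a k g
  sumFrom-distrib-+ a zero    f g = refl
  sumFrom-distrib-+ a (suc k) f g = begin
    (f a + g a) + sumFrom (suc a) k (λ i → f i + g i)
      ≡⟨ cong (f a + g a +_) (sumFrom-distrib-+ (suc a) k f g) ⟩
    (f a + g a) + (sumFrom (suc a) k f + sumFrom (suc a) k g)
      ≡⟨ +-interchange (f a) (g a) _ _ ⟩
    (f a + sumFrom (suc a) k f) + (g a + sumFrom (suc a) k g) ∎
    where open ≡-Reasoning

  sumFrom-*ʳ : ∀ a k c (f : ℕ → ℕ) → sumFrom a k (λ i → f i * c) ≡ sumFrom a k f * c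
  sumFrom-*ʳ a zero    c f = refl
  sumFrom-*ʳ a (suc k) c f = trans (cong (f a * c +_) (sumFrom-*ʳ (suc a) k c f))
                                   (sym (*-distribʳ-+ c (f a) _))

  sumFrom-suc : ∀ a k (f : ℕ → ℕ) → sumFrom (suc a) k f ≡ sumFrom a k (f ∘ suc)
  sumFrom-suc a zero    f = refl
  sumFrom-suc a (suc k) f = cong (f (suc a) +_) (sumFrom-suc (suc a) k f)

  sumFrom-++ : ∀ a k j (f : ℕ → ℕ) → sumFrom a (k + j) f ≡ sumFrom a k f + sumFrom (a + k) j f
  sumFrom-++ a zero    j f = cong (λ b → sumFrom b j f) (sym (+-identityʳ a))
  sumFrom-++ a (suc k) j f = trans (cong (f a +_) (trans (sumFrom-++ (suc a) k j f)
                                     (cong (λ b → sumFrom (suc a) k f + sumFrom b j f) (sym (+-suc a k)))))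
                                   (sym (+-assoc (f a) _ _))

  sumFrom-snoc : ∀ a k (f : ℕ → ℕ) → sumFrom a (suc k) f ≡ sumFrom a k f + f (a + k)
  sumFrom-snoc a k f = begin
    sumFrom a (suc k) f                  ≡⟨ cong (λ q → sumFrom a q f) (+-comm 1 k) ⟩
    sumFrom a (k + 1) f                  ≡⟨ sumFrom-++ a k 1 f ⟩
    sumFrom a k f + (f (a + k) + 0)      ≡⟨ cong (sumFrom a k f +_) (+-identityʳ _) ⟩
    sumFrom a k f + f (a + k)            ∎
    where open ≡-Reasoning

  sumFrom-++₃ : ∀ a l k r (f : ℕ → ℕ) →
                sumFrom a (l + (k + r)) f ≡ sumFrom a l f + (sumFrom (a + l) k f + sumFrom (a + l + k) r f)
  sumFrom-++₃ a l k r f = trans (sumFrom-++ a l (k + r) f) (cong (sumFrom a l f +_) (sumFrom-++ (a + l) k r f))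

  sumFrom-≤-extend : ∀ a k j (f : ℕ → ℕ) → sumFrom a k f ≤ sumFrom a (k + j) f
  sumFrom-≤-extend a k j f = subst (sumFrom a k f ≤_) (sym (sumFrom-++ a k j f)) (m≤m+n _ _)

  sumFrom-vanishing-tail : ∀ a k j (f : ℕ → ℕ) → (∀ i → a + k ≤ i → f i ≡ 0) →
                           sumFrom a (k + j) f ≡ sumFrom a k f
  sumFrom-vanishing-tail a k j f vanish = begin
    sumFrom a (k + j) f
      ≡⟨ sumFrom-++ a k j f ⟩
    sumFrom a k f + sumFrom (a + k) j f
      ≡⟨ cong (sumFrom a k f +_) (sumFrom-zero (a + k) j λ i a+k≤i _ → vanish i a+k≤i) ⟩
    sumFrom a k f + 0
      ≡⟨ +-identityʳ _ ⟩
    sumFrom a k f ∎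
    where open ≡-Reasoning

  sumFrom-shift : ∀ a d k (f : ℕ → ℕ) → sumFrom (a + d) k f ≡ sumFrom a k (λ i → f (i + d))
  sumFrom-shift a d zero    f = refl
  sumFrom-shift a d (suc k) f = cong (f (a + d) +_) (sumFrom-shift (suc a) d k f)

  sumFrom-comm : ∀ a k b j (f : ℕ → ℕ → ℕ) →
                 sumFrom a k (λ i → sumFrom b j (f i)) ≡ sumFrom b j (λ c → sumFrom a k (λ i → f i c))
  sumFrom-comm a zero    b j f = sym (sumFrom-zero b j λ _ _ _ → refl)
  sumFrom-comm a (suc k) b j f = trans (cong (sumFrom b j (f a) +_) (sumFrom-comm (suc a) k b j f))
                                       (sym (sumFrom-distrib-+ b j (f a) _))

  sumFrom-weighted-≤+ : ∀ a k (w f g : ℕ → ℕ) c → (∀ y → a ≤ y → y < a + k → f y ≤ g y + c) →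
                        sumFrom a k (λ y → w y * f y) ≤ sumFrom a k (λ y → w y * g y) + c * sumFrom a k w
  sumFrom-weighted-≤+ a k w f g c le = begin
    sumFrom a k (λ y → w y * f y)
      ≤⟨ sumFrom-mono a k (λ y a≤y y<e → *-monoʳ-≤ (w y) (le y a≤y y<e)) ⟩
    sumFrom a k (λ y → w y * (g y + c))
      ≡⟨ sumFrom-cong a k (λ y _ _ → *-distribˡ-+ (w y) (g y) c) ⟩
    sumFrom a k (λ y → w y * g y + w y * c)
      ≡⟨ sumFrom-distrib-+ a k _ _ ⟩
    sumFrom a k (λ y → w y * g y) + sumFrom a k (λ y → w y * c)
      ≡⟨ cong (sumFrom a k (λ y → w y * g y) +_) (trans (sumFrom-*ʳ a k c w) (*-comm _ c)) ⟩
    sumFrom a k (λ y → w y * g y) + c * sumFrom a k w ∎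
    where open ≤-Reasoning

  ⟦_<_⟧ : ℕ → ℕ → ℕ
  ⟦ c     < zero  ⟧ = 0
  ⟦ zero  < suc y ⟧ = 1
  ⟦ suc c < suc y ⟧ = ⟦ c < y ⟧

  ⟦_≡_⟧ : ℕ → ℕ → ℕ
  ⟦ zero  ≡ zero  ⟧ = 1
  ⟦ zero  ≡ suc y ⟧ = 0
  ⟦ suc x ≡ zero  ⟧ = 0
  ⟦ suc x ≡ suc y ⟧ = ⟦ x ≡ y ⟧

  ⟦<⟧-true : ∀ {c y} → c < y → ⟦ c < y ⟧ ≡ 1
  ⟦<⟧-true {zero}  {suc y} _         = refl
  ⟦<⟧-true {suc c} {suc y} (s≤s c<y) = ⟦<⟧-true c<y

  ⟦<⟧-false : ∀ {c y} → y ≤ c → ⟦ c < y ⟧ ≡ 0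
  ⟦<⟧-false {c}     {zero}  _         = refl
  ⟦<⟧-false {suc c} {suc y} (s≤s y≤c) = ⟦<⟧-false y≤c

  ⟦<⟧≤1 : ∀ c y → ⟦ c < y ⟧ ≤ 1
  ⟦<⟧≤1 c       zero    = z≤n
  ⟦<⟧≤1 zero    (suc y) = ≤-refl
  ⟦<⟧≤1 (suc c) (suc y) = ⟦<⟧≤1 c y

  ⟦≡⟧-refl : ∀ x → ⟦ x ≡ x ⟧ ≡ 1
  ⟦≡⟧-refl zero    = refl
  ⟦≡⟧-refl (suc x) = ⟦≡⟧-refl x

  ⟦≡⟧-false : ∀ {x y} → x ≢ y → ⟦ x ≡ y ⟧ ≡ 0
  ⟦≡⟧-false {zero}  {zero}  x≢y = contradiction refl x≢y
  ⟦≡⟧-false {zero}  {suc y} x≢y = refl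
  ⟦≡⟧-false {suc x} {zero}  x≢y = refl
  ⟦≡⟧-false {suc x} {suc y} x≢y = ⟦≡⟧-false (x≢y ∘ cong suc)

  sumFrom-⟦≡⟧ : ∀ a k x (f : ℕ → ℕ) → a ≤ x → x < a + k →
                   sumFrom a k (λ y → ⟦ x ≡ y ⟧ * f y) ≡ f x
  sumFrom-⟦≡⟧ a zero    x f a≤x x<a = contradiction (subst (x <_) (+-identityʳ a) x<a) (≤⇒≯ a≤x)
  sumFrom-⟦≡⟧ a (suc k) x f a≤x x<e with x ≟ a
  ... | yes refl = begin
    ⟦ x ≡ x ⟧ * f x + sumFrom (suc x) k (λ y → ⟦ x ≡ y ⟧ * f y)
      ≡⟨ cong₂ (λ u v → u * f x + v) (⟦≡⟧-refl x) rest ⟩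
    1 * f x + 0
      ≡⟨ trans (+-identityʳ _) (*-identityˡ (f x)) ⟩
    f x ∎
    where
    open ≡-Reasoning
    rest : sumFrom (suc x) k (λ y → ⟦ x ≡ y ⟧ * f y) ≡ 0
    rest = sumFrom-zero (suc x) k λ y x<y _ → cong (_* f y) (⟦≡⟧-false (<⇒≢ x<y))
  ... | no x≢a = cong₂ _+_ (cong (_* f a) (⟦≡⟧-false x≢a))
                           (sumFrom-⟦≡⟧ (suc a) k x f (≤∧≢⇒< a≤x (x≢a ∘ sym)) (subst (x <_) (+-suc a k) x<e))

  sumFrom-⟦<⟧ : ∀ c a k → sumFrom a k (λ y → ⟦ c < y ⟧) ≡ k ∸ (suc c ∸ a)
  sumFrom-⟦<⟧ c a zero = sym (0∸n≡0 (suc c ∸ a))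
  sumFrom-⟦<⟧ c a (suc k) with c <? a
  ... | yes c<a rewrite ⟦<⟧-true c<a | sumFrom-⟦<⟧ c (suc a) k | m≤n⇒m∸n≡0 c<a | m≤n⇒m∸n≡0 (<⇒≤ c<a) = refl
  ... | no c≮a rewrite ⟦<⟧-false (≮⇒≥ c≮a) | sumFrom-⟦<⟧ c (suc a) k | +-∸-assoc 1 (≮⇒≥ c≮a) = refl

  layer-cake : ∀ x K → x ≤ K → sumFrom 0 K (λ c → ⟦ c < x ⟧) ≡ x
  layer-cake zero    K       _         = sumFrom-zero 0 K λ _ _ _ → refl
  layer-cake (suc x) (suc K) (s≤s x≤K) = cong suc (trans (sumFrom-suc 0 K (λ c → ⟦ c < suc x ⟧)) (layer-cake x K x≤K))

  tent : ℕ → ℕ → ℕ → ℕ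
  tent p x c with c <? x
  ... | yes _ = suc c + p ∸ x
  ... | no  _ = x + p ∸ suc c

  tent-< : ∀ p {x c} → c < x → tent p x c ≡ suc c + p ∸ x
  tent-< p {x} {c} c<x with c <? x
  ... | yes _   = refl
  ... | no  c≮x = contradiction c<x c≮x

  tent-≥ : ∀ p {x c} → x ≤ c → tent p x c ≡ x + p ∸ suc c
  tent-≥ p {x} {c} x≤c with c <? x
  ... | yes c<x = contradiction x≤c (<⇒≱ c<x)
  ... | no  _   = refl

  triangular-sums : ∀ p → sumFrom 0 p (p ∸_) + sumFrom 0 p (λ j → p ∸ suc j) ≡ p * p
  triangular-sums zero    = refl
  triangular-sums (suc p) = begin
    (suc p + sumFrom 1 p (suc p ∸_)) + (p + sumFrom 1 p (λ j → suc p ∸ suc j))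
      ≡⟨ cong₂ (λ u v → (suc p + u) + (p + v)) (sumFrom-suc 0 p (suc p ∸_)) (sumFrom-suc 0 p (λ j → p ∸ j)) ⟩
    (suc p + sumFrom 0 p (p ∸_)) + (p + sumFrom 0 p (λ j → p ∸ suc j))
      ≡⟨ +-interchange (suc p) _ p _ ⟩
    (suc p + p) + (sumFrom 0 p (p ∸_) + sumFrom 0 p (λ j → p ∸ suc j))
      ≡⟨ cong (suc p + p +_) (triangular-sums p) ⟩
    suc p + p + p * p
      ≡⟨ trans (+-assoc (suc p) p _) (cong (suc p +_) (sym (*-suc p p))) ⟩
    suc p * suc p ∎
    where open ≡-Reasoning

  rising-half : ∀ p x → sumFrom 0 x (λ c → suc c + p ∸ x) ≡ sumFrom 0 x (p ∸_)
  rising-half p zero    = refl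
  rising-half p (suc x) = begin
    (p ∸ x) + sumFrom 1 x (λ c → suc c + p ∸ suc x)
      ≡⟨ cong ((p ∸ x) +_) (sumFrom-suc 0 x (λ c → suc c + p ∸ suc x)) ⟩
    (p ∸ x) + sumFrom 0 x (λ c → suc c + p ∸ x)
      ≡⟨ cong ((p ∸ x) +_) (rising-half p x) ⟩
    (p ∸ x) + sumFrom 0 x (p ∸_)
      ≡⟨ +-comm (p ∸ x) _ ⟩
    sumFrom 0 x (p ∸_) + (p ∸ x)
      ≡⟨ sumFrom-snoc 0 x (p ∸_) ⟨
    sumFrom 0 (suc x) (p ∸_) ∎
    where open ≡-Reasoning

  sumFrom-tent≤ : ∀ p x K → sumFrom 0 K (tent p x) ≤ p * p
  sumFrom-tent≤ p x K = begin
    sumFrom 0 K (tent p x)                                 ≤⟨ sumFrom-≤-extend 0 K (x + p) (tent p x) ⟩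
    sumFrom 0 (K + (x + p)) (tent p x)                     ≡⟨ cong (λ q → sumFrom 0 q (tent p x)) (+-comm K (x + p)) ⟩
    sumFrom 0 ((x + p) + K) (tent p x)                     ≡⟨ sumFrom-vanishing-tail 0 (x + p) K (tent p x) beyond ⟩
    sumFrom 0 (x + p) (tent p x)                           ≡⟨ sumFrom-++ 0 x p (tent p x) ⟩
    sumFrom 0 x (tent p x) + sumFrom x p (tent p x)        ≡⟨ cong₂ _+_ rising falling ⟩
    sumFrom 0 x (p ∸_) + sumFrom 0 p (λ j → p ∸ suc j)    ≤⟨ +-monoˡ-≤ _ shorter ⟩
    sumFrom 0 p (p ∸_) + sumFrom 0 p (λ j → p ∸ suc j)    ≡⟨ triangular-sums p ⟩
    p * p                                                  ∎
    where
    open ≤-Reasoning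
    beyond : ∀ c → x + p ≤ c → tent p x c ≡ 0
    beyond c x+p≤c = trans (tent-≥ p (≤-trans (m≤m+n x p) x+p≤c)) (m≤n⇒m∸n≡0 (m≤n⇒m≤1+n x+p≤c))
    rising : sumFrom 0 x (tent p x) ≡ sumFrom 0 x (p ∸_)
    rising = trans (sumFrom-cong 0 x λ c _ c<x → tent-< p c<x) (rising-half p x)
    falling : sumFrom x p (tent p x) ≡ sumFrom 0 p (λ j → p ∸ suc j)
    falling = trans (sumFrom-shift 0 x p (tent p x)) (sumFrom-cong 0 p λ j _ _ → begin-equality
      tent p x (j + x)          ≡⟨ tent-≥ p (m≤n+m x j) ⟩
      x + p ∸ suc (j + x)       ≡⟨ cong (x + p ∸_) (+-comm (suc j) x) ⟩
      x + p ∸ (x + suc j)       ≡⟨ [m+n]∸[m+o]≡n∸o x p (suc j) ⟩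
      p ∸ suc j                 ∎)
    shorter : sumFrom 0 x (p ∸_) ≤ sumFrom 0 p (p ∸_)
    shorter = begin
      sumFrom 0 x (p ∸_)        ≤⟨ sumFrom-≤-extend 0 x p (p ∸_) ⟩
      sumFrom 0 (x + p) (p ∸_)  ≡⟨ cong (λ q → sumFrom 0 q (p ∸_)) (+-comm x p) ⟩
      sumFrom 0 (p + x) (p ∸_)  ≡⟨ sumFrom-vanishing-tail 0 p x (p ∸_) (λ _ → m≤n⇒m∸n≡0) ⟩
      sumFrom 0 p (p ∸_)        ∎

  -- Stated pointwise, so that an empty AP qualifies whatever its start.
  WithinRange : ℕ → AP → Set
  WithinRange N (a , k) = ∀ i → i < k → 1 ≤ a + i × a + i ≤ N

  within-bounds : ∀ {N a k} → WithinRange N (a , suc k) → 1 ≤ a × a + suc k ≤ suc N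
  within-bounds {N} {a} {k} within =
    subst (1 ≤_) (+-identityʳ a) (proj₁ (within 0 z<s)) ,
    subst (_≤ suc N) (sym (+-suc a k)) (s≤s (proj₂ (within k ≤-refl)))

  l+[k+[N∸[l+k]]]≡N : ∀ {N l k} → suc l + k ≤ suc N → l + (k + (N ∸ (l + k))) ≡ N
  l+[k+[N∸[l+k]]]≡N {N} {l} {k} (s≤s l+k≤N) = trans (sym (+-assoc l k _)) (m+[n∸m]≡n l+k≤N)

  record BoundedPerm (N p : ℕ) : Set where
    field
      π      : ℕ → ℕ
      π-into : ∀ y → 1 ≤ y → y ≤ N → 1 ≤ π y × π y ≤ N
      π-onto : ∀ z → 1 ≤ z → z ≤ N → ∃ λ y → 1 ≤ y × y ≤ N × π y ≡ z
      π-inj  : ∀ y y′ → 1 ≤ y → y ≤ N → 1 ≤ y′ → y′ ≤ N → π y ≡ π y′ → y ≡ y′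
      π-up   : ∀ y → 1 ≤ y → y ≤ N → π y ≤ y + p
      π-down : ∀ y → 1 ≤ y → y ≤ N → y ≤ π y + p

  module _ {N p : ℕ} (σ : BoundedPerm N p) where
    open BoundedPerm σ

    private
      preimage-count : ∀ z → 1 ≤ z → z ≤ N → sumFrom 1 N (λ y → ⟦ π y ≡ z ⟧) ≡ 1
      preimage-count z 1≤z z≤N with π-onto z 1≤z z≤N
      ... | y₀ , 1≤y₀ , y₀≤N , πy₀≡z =
        trans (sumFrom-cong 1 N indicator) (sumFrom-⟦≡⟧ 1 N y₀ (λ _ → 1) 1≤y₀ (s≤s y₀≤N))
        where
        indicator : ∀ y → 1 ≤ y → y < 1 + N → ⟦ π y ≡ z ⟧ ≡ ⟦ y₀ ≡ y ⟧ * 1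
        indicator y 1≤y y<N+1 with y ≟ y₀
        ... | yes refl = trans (cong ⟦_≡ z ⟧ πy₀≡z) (trans (⟦≡⟧-refl z) (sym (cong (_* 1) (⟦≡⟧-refl y))))
        ... | no  y≢y₀ = trans (⟦≡⟧-false πy≢z) (sym (cong (_* 1) (⟦≡⟧-false (y≢y₀ ∘ sym))))
          where
          πy≢z : π y ≢ z
          πy≢z πy≡z = y≢y₀ (π-inj y y₀ 1≤y (s≤s⁻¹ y<N+1) 1≤y₀ y₀≤N (trans πy≡z (sym πy₀≡z)))

    sumFrom-∘π : ∀ (w : ℕ → ℕ) → sumFrom 1 N (w ∘ π) ≡ sumFrom 1 N w
    sumFrom-∘π w = begin
      sumFrom 1 N (w ∘ π)
        ≡⟨ sumFrom-cong 1 N (λ y 1≤y y<N+1 → sym (select y 1≤y (s≤s⁻¹ y<N+1))) ⟩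
      sumFrom 1 N (λ y → sumFrom 1 N (λ z → ⟦ π y ≡ z ⟧ * w z))
        ≡⟨ sumFrom-comm 1 N 1 N _ ⟩
      sumFrom 1 N (λ z → sumFrom 1 N (λ y → ⟦ π y ≡ z ⟧ * w z))
        ≡⟨ sumFrom-cong 1 N (λ z 1≤z z<N+1 → count z 1≤z (s≤s⁻¹ z<N+1)) ⟩
      sumFrom 1 N w ∎
      where
      open ≡-Reasoning
      select : ∀ y → 1 ≤ y → y ≤ N → sumFrom 1 N (λ z → ⟦ π y ≡ z ⟧ * w z) ≡ w (π y)
      select y 1≤y y≤N = let (1≤πy , πy≤N) = π-into y 1≤y y≤N in sumFrom-⟦≡⟧ 1 N (π y) w 1≤πy (s≤s πy≤N)
      count : ∀ z → 1 ≤ z → z ≤ N → sumFrom 1 N (λ y → ⟦ π y ≡ z ⟧ * w z) ≡ w z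
      count z 1≤z z≤N = begin
        sumFrom 1 N (λ y → ⟦ π y ≡ z ⟧ * w z) ≡⟨ sumFrom-*ʳ 1 N (w z) (λ y → ⟦ π y ≡ z ⟧) ⟩
        sumFrom 1 N (λ y → ⟦ π y ≡ z ⟧) * w z ≡⟨ cong (_* w z) (preimage-count z 1≤z z≤N) ⟩
        1 * w z                               ≡⟨ *-identityˡ (w z) ⟩
        w z                                   ∎

    private
      count-π-lower : ∀ c y → 1 ≤ y → y ≤ N → ⟦ c + p < y ⟧ ≤ ⟦ c < π y ⟧
      count-π-lower c y 1≤y y≤N with c + p <? y
      ... | yes c+p<y = ≤-reflexive (trans (⟦<⟧-true c+p<y)
                          (sym (⟦<⟧-true (+-cancelʳ-< p c (π y) (<-≤-trans c+p<y (π-down y 1≤y y≤N))))))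
      ... | no  c+p≮y = ≤-trans (≤-reflexive (⟦<⟧-false (≮⇒≥ c+p≮y))) z≤n

      count-π-upper : ∀ c y → 1 ≤ y → y ≤ N → ⟦ c < π y ⟧ ≤ ⟦ c < y + p ⟧
      count-π-upper c y 1≤y y≤N with c <? π y
      ... | yes c<πy = ≤-reflexive (trans (⟦<⟧-true c<πy) (sym (⟦<⟧-true (<-≤-trans c<πy (π-up y 1≤y y≤N)))))
      ... | no  c≮πy = ≤-trans (≤-reflexive (⟦<⟧-false (≮⇒≥ c≮πy))) z≤n

      sumFrom-⟦<⟧≤length : ∀ c x j (f : ℕ → ℕ) → sumFrom x j (λ y → ⟦ c < f y ⟧) ≤ j
      sumFrom-⟦<⟧≤length c x j f = ≤-trans (sumFrom-mono x j λ y _ _ → ⟦<⟧≤1 c (f y))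
                                     (≤-reflexive (trans (sumFrom-const x j 1) (*-identityʳ j)))

    -- [1, N] = [1, a) ∪ [a, e) ∪ [e, N]. Over all of [1, N] the counts agree (balance), and π
    -- changes the counts of the outer parts only near c; this bounds A c − B c by tent p e c and
    -- B c − A c by tent p a c.
    module Interval (l k r : ℕ) (l+k+r≡N : l + (k + r) ≡ N) where
      a e : ℕ
      a = suc l
      e = a + k

      split : ∀ f → sumFrom 1 N f ≡ sumFrom 1 l f + (sumFrom a k f + sumFrom e r f)
      split f = trans (cong (λ q → sumFrom 1 q f) (sym l+k+r≡N)) (sumFrom-++₃ 1 l k r f)

      ≤N : ∀ {y} → y < e + r → y ≤ N
      ≤N {y} (s≤s y≤) = subst (y ≤_) (trans (+-assoc l k r) l+k+r≡N) y≤

      A B : ℕ → ℕ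
      A c = sumFrom a k (λ y → ⟦ c < π y ⟧)
      B c = sumFrom a k (λ y → ⟦ c < y ⟧)

      balance : ∀ c → sumFrom 1 l (λ y → ⟦ c < π y ⟧) + (A c + sumFrom e r (λ y → ⟦ c < π y ⟧))
                    ≡ sumFrom 1 l (λ y → ⟦ c < y ⟧) + (B c + sumFrom e r (λ y → ⟦ c < y ⟧))
      balance c = trans (sym (split (λ y → ⟦ c < π y ⟧))) (trans (sumFrom-∘π ⟦ c <_⟧) (split ⟦ c <_⟧))

      nothing-left-above : ∀ c → a ≤ c → sumFrom 1 l (λ y → ⟦ c < y ⟧) ≡ 0
      nothing-left-above c a≤c = sumFrom-zero 1 l λ y _ y<a → ⟦<⟧-false (≤-trans (<⇒≤ y<a) a≤c)

      all-right-above : ∀ c → c < e → sumFrom e r (λ y → ⟦ c < y ⟧) ≡ r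
      all-right-above c c<e = trans (sumFrom-cong e r λ y e≤y _ → ⟦<⟧-true (<-≤-trans c<e e≤y))
                                    (trans (sumFrom-const e r 1) (*-identityʳ r))

      all-inside-above : ∀ c → c < a → B c ≡ k
      all-inside-above c c<a = trans (sumFrom-⟦<⟧ c a k) (cong (k ∸_) (m≤n⇒m∸n≡0 c<a))

      nothing-inside-above : ∀ c → e ≤ c → B c ≡ 0
      nothing-inside-above c e≤c = sumFrom-zero a k λ y _ y<e → ⟦<⟧-false (≤-trans (<⇒≤ y<e) e≤c)

      1≤ : ∀ {y} → a ≤ y → 1 ≤ y
      1≤ = ≤-trans (s≤s z≤n)

      inside≤N : ∀ {y} → y < e → y ≤ N
      inside≤N y<e = ≤N (<-≤-trans y<e (m≤m+n e r))

      excess-inside : ∀ c → a ≤ c → c < e → A c ≤ B c + (suc c + p ∸ e)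
      excess-inside c a≤c c<e = +-cancelʳ-≤ (r ∸ d) (A c) (B c + d) (begin
        A c + (r ∸ d)
          ≤⟨ +-monoʳ-≤ (A c) right-still-above ⟩
        A c + Rπ
          ≤⟨ m≤n+m (A c + Rπ) Lπ ⟩
        Lπ + (A c + Rπ)
          ≡⟨ balance c ⟩
        sumFrom 1 l ⟦ c <_⟧ + (B c + sumFrom e r ⟦ c <_⟧)
          ≡⟨ cong₂ (λ u v → u + (B c + v)) (nothing-left-above c a≤c) (all-right-above c c<e) ⟩
        B c + r
          ≤⟨ +-monoʳ-≤ (B c) (m≤n+m∸n r d) ⟩
        B c + (d + (r ∸ d))
          ≡⟨ sym (+-assoc (B c) d _) ⟩
        B c + d + (r ∸ d) ∎)
        where
        open ≤-Reasoning
        d Lπ Rπ : ℕ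
        d = suc c + p ∸ e
        Lπ = sumFrom 1 l (λ y → ⟦ c < π y ⟧)
        Rπ = sumFrom e r (λ y → ⟦ c < π y ⟧)
        right-still-above : r ∸ d ≤ Rπ
        right-still-above = begin
          r ∸ d
            ≡⟨ sumFrom-⟦<⟧ (c + p) e r ⟨
          sumFrom e r ⟦ c + p <_⟧
            ≤⟨ sumFrom-mono e r (λ y e≤y y<e+r → count-π-lower c y (1≤ (≤-trans (m≤m+n a k) e≤y)) (≤N y<e+r)) ⟩
          Rπ ∎

      excess-after : ∀ c → e ≤ c → A c ≤ e + p ∸ suc c
      excess-after c e≤c = begin
        A c
          ≤⟨ sumFrom-mono a k (λ y a≤y y<e → count-π-upper c y (1≤ a≤y) (inside≤N y<e)) ⟩
        sumFrom a k (λ y → ⟦ c < y + p ⟧)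
          ≡⟨ sumFrom-shift a p k ⟦ c <_⟧ ⟨
        sumFrom (a + p) k ⟦ c <_⟧
          ≡⟨ sumFrom-⟦<⟧ c (a + p) k ⟩
        k ∸ (suc c ∸ (a + p))
          ≤⟨ m∸[n∸o]≤m+o∸n k (suc c) (a + p) ⟩
        k + (a + p) ∸ suc c
          ≡⟨ cong (_∸ suc c) (trans (sym (+-assoc k a p)) (cong (_+ p) (+-comm k a))) ⟩
        e + p ∸ suc c ∎
        where open ≤-Reasoning

      excess≤tent : ∀ c → A c ≤ B c + tent p e c
      excess≤tent c = by-cases (c <? a) (c <? e)
        where
        by-cases : Dec (c < a) → Dec (c < e) → A c ≤ B c + tent p e c
        by-cases (yes c<a) _         =
          ≤-trans (sumFrom-⟦<⟧≤length c a k π) (≤-trans (≤-reflexive (sym (all-inside-above c c<a))) (m≤m+n (B c) _))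
        by-cases (no  c≮a) (yes c<e) =
          subst (λ t → A c ≤ B c + t) (sym (tent-< p c<e)) (excess-inside c (≮⇒≥ c≮a) c<e)
        by-cases (no  _)   (no  c≮e) =
          subst (λ t → A c ≤ B c + t) (sym (tent-≥ p (≮⇒≥ c≮e))) (≤-trans (excess-after c (≮⇒≥ c≮e)) (m≤n+m _ (B c)))

      deficit-before : ∀ c → c < a → B c ≤ A c + (suc c + p ∸ a)
      deficit-before c c<a = begin
        B c
          ≡⟨ all-inside-above c c<a ⟩
        k
          ≤⟨ m≤n+m∸n k d ⟩
        d + (k ∸ d)
          ≡⟨ +-comm d _ ⟩
        (k ∸ d) + d
          ≡⟨ cong (_+ d) (sumFrom-⟦<⟧ (c + p) a k) ⟨
        sumFrom a k ⟦ c + p <_⟧ + d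
          ≤⟨ +-monoˡ-≤ d (sumFrom-mono a k λ y a≤y y<e → count-π-lower c y (1≤ a≤y) (inside≤N y<e)) ⟩
        A c + d ∎
        where
        open ≤-Reasoning
        d : ℕ
        d = suc c + p ∸ a

      deficit-inside : ∀ c → a ≤ c → c < e → B c ≤ A c + (a + p ∸ suc c)
      deficit-inside c a≤c c<e = +-cancelʳ-≤ r (B c) (A c + (a + p ∸ suc c)) (begin
        B c + r
          ≡⟨ cong₂ (λ u v → u + (B c + v)) (nothing-left-above c a≤c) (all-right-above c c<e) ⟨
        sumFrom 1 l ⟦ c <_⟧ + (B c + sumFrom e r ⟦ c <_⟧)
          ≡⟨ balance c ⟨
        Lπ + (A c + Rπ)
          ≤⟨ +-mono-≤ left-still-below (+-monoʳ-≤ (A c) (sumFrom-⟦<⟧≤length c e r π)) ⟩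
        (a + p ∸ suc c) + (A c + r)
          ≡⟨ sym (+-assoc _ (A c) r) ⟩
        (a + p ∸ suc c) + A c + r
          ≡⟨ cong (_+ r) (+-comm _ (A c)) ⟩
        A c + (a + p ∸ suc c) + r ∎)
        where
        open ≤-Reasoning
        Lπ Rπ : ℕ
        Lπ = sumFrom 1 l (λ y → ⟦ c < π y ⟧)
        Rπ = sumFrom e r (λ y → ⟦ c < π y ⟧)
        left-still-below : Lπ ≤ a + p ∸ suc c
        left-still-below = begin
          Lπ
            ≤⟨ sumFrom-mono 1 l (λ y 1≤y y<a → count-π-upper c y 1≤y (≤N (<-≤-trans y<a (≤-trans (m≤m+n a k) (m≤m+n e r))))) ⟩
          sumFrom 1 l (λ y → ⟦ c < y + p ⟧)
            ≡⟨ sumFrom-shift 1 p l ⟦ c <_⟧ ⟨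
          sumFrom (1 + p) l ⟦ c <_⟧
            ≡⟨ sumFrom-⟦<⟧ c (1 + p) l ⟩
          l ∸ (suc c ∸ (1 + p))
            ≤⟨ m∸[n∸o]≤m+o∸n l (suc c) (1 + p) ⟩
          l + (1 + p) ∸ suc c
            ≡⟨ cong (_∸ suc c) (+-suc l p) ⟩
          a + p ∸ suc c ∎

      deficit≤tent : ∀ c → B c ≤ A c + tent p a c
      deficit≤tent c = by-cases (c <? a) (c <? e)
        where
        by-cases : Dec (c < a) → Dec (c < e) → B c ≤ A c + tent p a c
        by-cases (yes c<a) _         =
          subst (λ t → B c ≤ A c + t) (sym (tent-< p c<a)) (deficit-before c c<a)
        by-cases (no  c≮a) (yes c<e) =
          subst (λ t → B c ≤ A c + t) (sym (tent-≥ p (≮⇒≥ c≮a))) (deficit-inside c (≮⇒≥ c≮a) c<e)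
        by-cases (no  _)   (no  c≮e) =
          subst (_≤ A c + tent p a c) (sym (nothing-inside-above c (≮⇒≥ c≮e))) z≤n

      sum-by-layers : ∀ (h : ℕ → ℕ) → (∀ y → a ≤ y → y < e → h y ≤ suc N) →
                      sumFrom a k h ≡ sumFrom 0 (suc N) (λ c → sumFrom a k (λ y → ⟦ c < h y ⟧))
      sum-by-layers h bounded = trans (sumFrom-cong a k λ y a≤y y<e → sym (layer-cake (h y) (suc N) (bounded y a≤y y<e)))
                                      (sumFrom-comm a k 0 (suc N) _)

      sumπ-by-layers : sumFrom a k π ≡ sumFrom 0 (suc N) A
      sumπ-by-layers = sum-by-layers π λ y a≤y y<e → m≤n⇒m≤1+n (proj₂ (π-into y (1≤ a≤y) (inside≤N y<e)))

      sumid-by-layers : sumFrom a k id ≡ sumFrom 0 (suc N) B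
      sumid-by-layers = sum-by-layers id λ y _ y<e → m≤n⇒m≤1+n (inside≤N y<e)

      block-upper : sumFrom a k π ≤ sumFrom a k id + p * p
      block-upper = begin
        sumFrom a k π                                          ≡⟨ sumπ-by-layers ⟩
        sumFrom 0 (suc N) A                                    ≤⟨ sumFrom-mono 0 (suc N) (λ c _ _ → excess≤tent c) ⟩
        sumFrom 0 (suc N) (λ c → B c + tent p e c)             ≡⟨ sumFrom-distrib-+ 0 (suc N) B (tent p e) ⟩
        sumFrom 0 (suc N) B + sumFrom 0 (suc N) (tent p e)     ≤⟨ +-monoʳ-≤ _ (sumFrom-tent≤ p e (suc N)) ⟩
        sumFrom 0 (suc N) B + p * p                            ≡⟨ cong (_+ p * p) sumid-by-layers ⟨
        sumFrom a k id + p * p                                 ∎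
        where open ≤-Reasoning

      block-lower : sumFrom a k id ≤ sumFrom a k π + p * p
      block-lower = begin
        sumFrom a k id                                         ≡⟨ sumid-by-layers ⟩
        sumFrom 0 (suc N) B                                    ≤⟨ sumFrom-mono 0 (suc N) (λ c _ _ → deficit≤tent c) ⟩
        sumFrom 0 (suc N) (λ c → A c + tent p a c)             ≡⟨ sumFrom-distrib-+ 0 (suc N) A (tent p a) ⟩
        sumFrom 0 (suc N) A + sumFrom 0 (suc N) (tent p a)     ≤⟨ +-monoʳ-≤ _ (sumFrom-tent≤ p a (suc N)) ⟩
        sumFrom 0 (suc N) A + p * p                            ≡⟨ cong (_+ p * p) sumπ-by-layers ⟨
        sumFrom a k π + p * p                                  ∎
        where open ≤-Reasoning

    block-upper : ∀ {a k} → WithinRange N (a , k) → sumFrom a k π ≤ sumFrom a k id + p * p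
    block-upper {a}     {zero}  _      = z≤n
    block-upper {zero}  {suc k} within = contradiction (proj₁ (within-bounds within)) λ ()
    block-upper {suc l} {suc k} within =
      Interval.block-upper l (suc k) (N ∸ (l + suc k)) (l+[k+[N∸[l+k]]]≡N {N} {l} (proj₂ (within-bounds within)))

    block-lower : ∀ {a k} → WithinRange N (a , k) → sumFrom a k id ≤ sumFrom a k π + p * p
    block-lower {a}     {zero}  _      = z≤n
    block-lower {zero}  {suc k} within = contradiction (proj₁ (within-bounds within)) λ ()
    block-lower {suc l} {suc k} within =
      Interval.block-lower l (suc k) (N ∸ (l + suc k)) (l+[k+[N∸[l+k]]]≡N {N} {l} (proj₂ (within-bounds within)))

  sumOver : AP → (ℕ → ℕ) → ℕ
  sumOver (a , k) = sumFrom a k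

  χ : AP → ℕ → ℕ
  χ (a , k) y = ⟦ y < a + k ⟧ ∸ ⟦ y < a ⟧

  χs : List AP → ℕ → ℕ
  χs as y = sum (map (λ A → χ A y) as)

  χ-inside : ∀ {a k y} → a ≤ y → y < a + k → χ (a , k) y ≡ 1
  χ-inside a≤y y<a+k rewrite ⟦<⟧-true y<a+k | ⟦<⟧-false a≤y = refl

  χ-below : ∀ {a k y} → y < a → χ (a , k) y ≡ 0
  χ-below {a} {k} y<a rewrite ⟦<⟧-true y<a | ⟦<⟧-true (≤-trans y<a (m≤m+n a k)) = refl

  χ-above : ∀ {a k y} → a + k ≤ y → χ (a , k) y ≡ 0
  χ-above {a} {k} {y} a+k≤y rewrite ⟦<⟧-false a+k≤y = 0∸n≡0 ⟦ y < a ⟧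

  χ-empty : ∀ a y → χ (a , 0) y ≡ 0
  χ-empty a y rewrite +-identityʳ a = n∸n≡0 ⟦ y < a ⟧

  sumFrom-χ : ∀ {N} A (h : ℕ → ℕ) → WithinRange N A → sumFrom 1 N (λ y → χ A y * h y) ≡ sumOver A h
  sumFrom-χ {N} (a , zero) h _ = sumFrom-zero 1 N λ y _ _ → cong (_* h y) (χ-empty a y)
  sumFrom-χ {N} (zero , suc k) h within = contradiction (proj₁ (within-bounds within)) λ ()
  sumFrom-χ {N} (suc l , suc k) h within = begin
    sumFrom 1 N (λ y → χ I y * h y)
      ≡⟨ cong (λ q → sumFrom 1 q (λ y → χ I y * h y)) (sym whole) ⟩
    sumFrom 1 (l + (suc k + r)) (λ y → χ I y * h y)
      ≡⟨ sumFrom-++₃ 1 l (suc k) r _ ⟩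
    Σχh 1 l + (Σχh (suc l) (suc k) + Σχh (suc l + suc k) r)
      ≡⟨ cong₂ (λ u v → u + (Σχh (suc l) (suc k) + v)) left right ⟩
    0 + (Σχh (suc l) (suc k) + 0)
      ≡⟨ +-identityʳ _ ⟩
    Σχh (suc l) (suc k)
      ≡⟨ sumFrom-cong (suc l) (suc k) (λ y a≤y y<e → trans (cong (_* h y) (χ-inside a≤y y<e)) (*-identityˡ (h y))) ⟩
    sumFrom (suc l) (suc k) h ∎
    where
    open ≡-Reasoning
    I : AP
    I = (suc l , suc k)
    r : ℕ
    r = N ∸ (l + suc k)
    whole : l + (suc k + r) ≡ N
    whole = l+[k+[N∸[l+k]]]≡N {N} {l} (proj₂ (within-bounds within))
    Σχh : ℕ → ℕ → ℕ
    Σχh b j = sumFrom b j (λ y → χ I y * h y)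
    left : Σχh 1 l ≡ 0
    left = sumFrom-zero 1 l λ y _ y<a → cong (_* h y) (χ-below y<a)
    right : Σχh (suc l + suc k) r ≡ 0
    right = sumFrom-zero (suc l + suc k) r λ y e≤y _ → cong (_* h y) (χ-above {suc l} {suc k} e≤y)

  Inside : (ℕ → Set) → AP → Set
  Inside P (a , k) = ∀ i → i < k → P (a + i)

  χ-disjoint : ∀ {A B y} → Disjoint A B → proj₁ A ≤ y → y < proj₁ A + apLen A → χ B y ≡ 0
  χ-disjoint {a , k} {b , j} (inj₁ a+k≤b) a≤y y<a+k = χ-below {b} {j} (<-≤-trans y<a+k a+k≤b)
  χ-disjoint {a , k} {b , j} (inj₂ b+j≤a) a≤y y<a+k = χ-above {b} {j} (≤-trans b+j≤a a≤y)

  χs≤ : ∀ {P : ℕ → Set} (w : ℕ → ℕ) → (∀ y → P y → 1 ≤ w y) →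
        ∀ {as} → AllPairs Disjoint as → All (Inside P) as → ∀ y → χs as y ≤ w y
  χs≤ w positive []                   []                         y = z≤n
  χs≤ {P} w positive {(a , k) ∷ bs} (apart ∷ pairwise) (inside ∷ insides) y with a ≤? y | y <? a + k
  ... | yes a≤y | yes y<a+k = begin
    χ (a , k) y + χs bs y
      ≡⟨ cong₂ _+_ (χ-inside a≤y y<a+k) (vanish bs apart) ⟩
    1
      ≤⟨ positive y (subst P (m+[n∸m]≡n a≤y) (inside (y ∸ a) (subst (y ∸ a <_) (m+n∸m≡n a k) (∸-monoˡ-< y<a+k a≤y)))) ⟩
    w y ∎
    where
    open ≤-Reasoning
    vanish : ∀ cs → All (Disjoint (a , k)) cs → χs cs y ≡ 0
    vanish []       []              = refl
    vanish (C ∷ cs) (apartC ∷ apart) = cong₂ _+_ (χ-disjoint {a , k} {C} apartC a≤y y<a+k) (vanish cs apart)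
  ... | no  a≰y | _         =
    subst (_≤ w y) (sym (cong (_+ χs bs y) (χ-below {a} {k} (≰⇒> a≰y)))) (χs≤ w positive pairwise insides y)
  ... | yes _   | no  y≮a+k =
    subst (_≤ w y) (sym (cong (_+ χs bs y) (χ-above {a} {k} (≮⇒≥ y≮a+k)))) (χs≤ w positive pairwise insides y)

  sum-map-≤+ : ∀ {A : Set} {P : A → Set} {xs : List A} (f g : A → ℕ) c →
               All P xs → (∀ {x} → P x → f x ≤ g x + c) → sum (map f xs) ≤ sum (map g xs) + length xs * c
  sum-map-≤+ f g c []                   le = z≤n
  sum-map-≤+ f g c (_∷_ {x} {xs} px pxs) le = begin
    f x + sum (map f xs)                          ≤⟨ +-mono-≤ (le px) (sum-map-≤+ f g c pxs le) ⟩
    (g x + c) + (sum (map g xs) + length xs * c)  ≡⟨ +-interchange (g x) c _ _ ⟩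
    (g x + sum (map g xs)) + (c + length xs * c)  ∎
    where open ≤-Reasoning

  module WeightedSums {N : ℕ} (w : ℕ → ℕ) (as : List AP)
                      (within : All (WithinRange N) as) (covered : ∀ y → χs as y ≤ w y) where

    residual : ℕ → ℕ
    residual y = w y ∸ χs as y

    sumFrom-χs : ∀ h → sumFrom 1 N (λ y → χs as y * h y) ≡ sum (map (λ A → sumOver A h) as)
    sumFrom-χs h = go as within
      where
      go : ∀ bs → All (WithinRange N) bs → sumFrom 1 N (λ y → χs bs y * h y) ≡ sum (map (λ A → sumOver A h) bs)
      go []       []             = sumFrom-zero 1 N λ _ _ _ → refl
      go (A ∷ bs) (inA ∷ inbs) = begin
        sumFrom 1 N (λ y → (χ A y + χs bs y) * h y)
          ≡⟨ sumFrom-cong 1 N (λ y _ _ → *-distribʳ-+ (h y) (χ A y) _) ⟩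
        sumFrom 1 N (λ y → χ A y * h y + χs bs y * h y)
          ≡⟨ sumFrom-distrib-+ 1 N _ _ ⟩
        sumFrom 1 N (λ y → χ A y * h y) + sumFrom 1 N (λ y → χs bs y * h y)
          ≡⟨ cong₂ _+_ (sumFrom-χ A h inA) (go bs inbs) ⟩
        sumOver A h + sum (map (λ A → sumOver A h) bs) ∎
        where open ≡-Reasoning

    decompose : ∀ h → sumFrom 1 N (λ y → w y * h y) ≡
                      sum (map (λ A → sumOver A h) as) + sumFrom 1 N (λ y → residual y * h y)
    decompose h = begin
      sumFrom 1 N (λ y → w y * h y)
        ≡⟨ sumFrom-cong 1 N (λ y _ _ → cong (_* h y) (sym (m+[n∸m]≡n (covered y)))) ⟩
      sumFrom 1 N (λ y → (χs as y + residual y) * h y)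
        ≡⟨ sumFrom-cong 1 N (λ y _ _ → *-distribʳ-+ (h y) (χs as y) _) ⟩
      sumFrom 1 N (λ y → χs as y * h y + residual y * h y)
        ≡⟨ sumFrom-distrib-+ 1 N _ _ ⟩
      sumFrom 1 N (λ y → χs as y * h y) + sumFrom 1 N (λ y → residual y * h y)
        ≡⟨ cong (_+ sumFrom 1 N (λ y → residual y * h y)) (sumFrom-χs h) ⟩
      sum (map (λ A → sumOver A h) as) + sumFrom 1 N (λ y → residual y * h y) ∎
      where open ≡-Reasoning

    total-weight : sumFrom 1 N w ≡ sum (map apLen as) + sumFrom 1 N residual
    total-weight = begin
      sumFrom 1 N w
        ≡⟨ sumFrom-cong 1 N (λ y _ _ → sym (*-identityʳ (w y))) ⟩
      sumFrom 1 N (λ y → w y * 1)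
        ≡⟨ decompose (λ _ → 1) ⟩
      sum (map (λ A → sumOver A (λ _ → 1)) as) + sumFrom 1 N (λ y → residual y * 1)
        ≡⟨ cong₂ _+_ (cong sum (map-cong length-sum as)) (sumFrom-cong 1 N (λ y _ _ → *-identityʳ (residual y))) ⟩
      sum (map apLen as) + sumFrom 1 N residual ∎
      where
      open ≡-Reasoning
      length-sum : ∀ A → sumOver A (λ _ → 1) ≡ apLen A
      length-sum (a , k) = trans (sumFrom-const a k 1) (*-identityʳ k)

    perturbation : ∀ {p} (f g : ℕ → ℕ) →
                   (∀ {A} → WithinRange N A → sumOver A f ≤ sumOver A g + p * p) →
                   (∀ y → 1 ≤ y → y ≤ N → f y ≤ g y + p) →
                   sumFrom 1 N (λ y → w y * f y) ≤
                     sumFrom 1 N (λ y → w y * g y) + (length as * (p * p) + p * sumFrom 1 N residual)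
    perturbation {p} f g on-blocks pointwise = begin
      sumFrom 1 N (λ y → w y * f y)                       ≡⟨ decompose f ⟩
      Σblocks f + Σresidual f
        ≤⟨ +-mono-≤ (sum-map-≤+ (λ A → sumOver A f) (λ A → sumOver A g) (p * p) within on-blocks)
                    (sumFrom-weighted-≤+ 1 N residual f g p λ y 1≤y y<N+1 → pointwise y 1≤y (s≤s⁻¹ y<N+1)) ⟩
      (Σblocks g + length as * (p * p)) + (Σresidual g + p * sumFrom 1 N residual)
        ≡⟨ +-interchange (Σblocks g) _ _ _ ⟩
      (Σblocks g + Σresidual g) + (length as * (p * p) + p * sumFrom 1 N residual)
        ≡⟨ cong (_+ _) (decompose g) ⟨
      sumFrom 1 N (λ y → w y * g y) + (length as * (p * p) + p * sumFrom 1 N residual) ∎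
      where
      open ≤-Reasoning
      Σblocks Σresidual : (ℕ → ℕ) → ℕ
      Σblocks h = sum (map (λ A → sumOver A h) as)
      Σresidual h = sumFrom 1 N (λ y → residual y * h y)

  fibre : ∀ {A : Set} → (A → ℕ) → ℕ → List A → ℕ
  fibre f y xs = sum (map (λ x → ⟦ f x ≡ y ⟧) xs)

  sum-by-fibres : ∀ {A : Set} K (f : A → ℕ) (h : ℕ → ℕ) → (∀ x → f x ≤ K) →
                  ∀ xs → sum (map (h ∘ f) xs) ≡ sumFrom 0 (suc K) (λ y → fibre f y xs * h y)
  sum-by-fibres K f h bounded []       = sym (sumFrom-zero 0 (suc K) λ _ _ _ → refl)
  sum-by-fibres K f h bounded (x ∷ xs) = begin
    h (f x) + sum (map (h ∘ f) xs)
      ≡⟨ cong₂ _+_ (sym (sumFrom-⟦≡⟧ 0 (suc K) (f x) h z≤n (s≤s (bounded x)))) (sum-by-fibres K f h bounded xs) ⟩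
    sumFrom 0 (suc K) (λ y → ⟦ f x ≡ y ⟧ * h y) + sumFrom 0 (suc K) (λ y → fibre f y xs * h y)
      ≡⟨ sumFrom-distrib-+ 0 (suc K) (λ y → ⟦ f x ≡ y ⟧ * h y) (λ y → fibre f y xs * h y) ⟨
    sumFrom 0 (suc K) (λ y → ⟦ f x ≡ y ⟧ * h y + fibre f y xs * h y)
      ≡⟨ sumFrom-cong 0 (suc K) (λ y _ _ → sym (*-distribʳ-+ (h y) ⟦ f x ≡ y ⟧ _)) ⟩
    sumFrom 0 (suc K) (λ y → fibre f y (x ∷ xs) * h y) ∎
    where open ≡-Reasoning

  fibre-∈ : ∀ {A : Set} (f : A → ℕ) {x xs} → x ∈ xs → 1 ≤ fibre f (f x) xs
  fibre-∈ f {x} (here refl) = ≤-trans (≤-reflexive (sym (⟦≡⟧-refl (f x)))) (m≤m+n _ _)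
  fibre-∈ f     (there x∈xs) = ≤-trans (fibre-∈ f x∈xs) (m≤n+m _ _)

  sum-fibres : ∀ {A : Set} K (f : A → ℕ) → (∀ x → f x ≤ K) →
               ∀ xs → sumFrom 0 (suc K) (λ y → fibre f y xs) ≡ length xs
  sum-fibres K f bounded xs = begin
    sumFrom 0 (suc K) (λ y → fibre f y xs)      ≡⟨ sumFrom-cong 0 (suc K) (λ y _ _ → sym (*-identityʳ _)) ⟩
    sumFrom 0 (suc K) (λ y → fibre f y xs * 1)  ≡⟨ sum-by-fibres K f (λ _ → 1) bounded xs ⟨
    sum (map (λ _ → 1) xs)                      ≡⟨ sum-ones xs ⟩
    length xs                                   ∎
    where
    open ≡-Reasoning
    sum-ones : ∀ {A : Set} (xs : List A) → sum (map (λ _ → 1) xs) ≡ length xs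
    sum-ones []       = refl
    sum-ones (_ ∷ xs) = cong suc (sum-ones xs)

  module _ {n : ℕ} (t : Labeling n) where
    private module t = Bijection t

    label≤ε : ∀ e → label t e ≤ ε n
    label≤ε e = toℕ<n (t.to e)

    label-injective : ∀ {e e′} → label t e ≡ label t e′ → e ≡ e′
    label-injective eq = t.injective (toℕ-injective (suc-injective eq))

    label-onto : ∀ y → 1 ≤ y → y ≤ ε n → ∃ λ e → label t e ≡ y
    label-onto (suc x) _ x<ε with t.strictlySurjective (fromℕ< x<ε)
    ... | e , to-e≡x = e , cong suc (trans (cong toℕ to-e≡x) (toℕ-fromℕ< x<ε))

    edge : ∀ x → x < ε n → Edge n
    edge x x<ε = proj₁ (label-onto (suc x) (s≤s z≤n) x<ε)

    edge-label : ∀ e (x<ε : toℕ (t.to e) < ε n) → edge (toℕ (t.to e)) x<ε ≡ e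
    edge-label e x<ε = label-injective (proj₂ (label-onto (suc (toℕ (t.to e))) (s≤s z≤n) x<ε))

  module _ {n : ℕ} (t θt : Labeling n) where

    relabel : ℕ → ℕ
    relabel zero = zero
    relabel (suc x) with x <? ε n
    ... | yes x<ε = label θt (edge t x x<ε)
    ... | no  _   = suc x

    relabel-label : ∀ e → relabel (label t e) ≡ label θt e
    relabel-label e with toℕ (Bijection.to t e) <? ε n
    ... | yes x<ε = cong (label θt) (edge-label t e x<ε)
    ... | no  x≮ε = contradiction (label≤ε t e) x≮ε

    labAt-relabel : ∀ u w → labAt θt u w ≡ relabel (labAt t u w)
    labAt-relabel u w with Finₚ.<-cmp u w
    ... | tri< _ _ _ = sym (relabel-label _)
    ... | tri≈ _ _ _ = refl
    ... | tri> _ _ _ = sym (relabel-label _)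

    relabelling : ∀ {p} → IsPSwap p t θt → BoundedPerm (ε n) p
    relabelling {p} swap = record
      { π      = relabel
      ; π-into = λ y 1≤y y≤ε → let (e , le≡y) = label-onto t y 1≤y y≤ε in
                   subst (λ y → 1 ≤ relabel y × relabel y ≤ ε n) le≡y
                     (subst (λ z → 1 ≤ z × z ≤ ε n) (sym (relabel-label e)) (s≤s z≤n , label≤ε θt e))
      ; π-onto = λ z 1≤z z≤ε → let (e , θe≡z) = label-onto θt z 1≤z z≤ε in
                   label t e , s≤s z≤n , label≤ε t e , trans (relabel-label e) θe≡z
      ; π-inj  = λ y y′ 1≤y y≤ε 1≤y′ y′≤ε → injective (label-onto t y 1≤y y≤ε) (label-onto t y′ 1≤y′ y′≤ε)
      ; π-up   = λ y 1≤y y≤ε → by-label {λ y z → z ≤ y + p} (λ e → ∣m-n∣≤o⇒n≤m+o {label t e} (swap e))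
                                          (label-onto t y 1≤y y≤ε)
      ; π-down = λ y 1≤y y≤ε → by-label {λ y z → y ≤ z + p} (λ e → ∣m-n∣≤o⇒m≤n+o {label t e} (swap e))
                                          (label-onto t y 1≤y y≤ε)
      }
      where
      by-label : ∀ {R : ℕ → ℕ → Set} → (∀ e → R (label t e) (label θt e)) →
                 ∀ {y} → (∃ λ e → label t e ≡ y) → R y (relabel y)
      by-label {R} holds (e , refl) = subst (R (label t e)) (sym (relabel-label e)) (holds e)
      injective : ∀ {y y′} → (∃ λ e → label t e ≡ y) → (∃ λ e → label t e ≡ y′) →
                  relabel y ≡ relabel y′ → y ≡ y′
      injective (e , refl) (e′ , refl) eq =
        cong (label t) (label-injective θt (trans (sym (relabel-label e)) (trans eq (relabel-label e′))))

  module _ {n : ℕ} (t : Labeling n) (u : Fin n) where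

    labAt≤ε : ∀ w → labAt t u w ≤ ε n
    labAt≤ε w with Finₚ.<-cmp u w
    ... | tri< _ _ _ = label≤ε t _
    ... | tri≈ _ _ _ = z≤n
    ... | tri> _ _ _ = label≤ε t _

    labAt-self : labAt t u u ≡ 0
    labAt-self with Finₚ.<-cmp u u
    ... | tri< u<u _ _ = contradiction u<u (Finₚ.<-irrefl refl)
    ... | tri≈ _ _ _   = refl
    ... | tri> _ _ u>u = contradiction u>u (Finₚ.<-irrefl refl)

    InS⇒range : ∀ {y} → InS t u y → 1 ≤ y × y ≤ ε n
    InS⇒range (e , _ , refl) = s≤s z≤n , label≤ε t e

    InS⇒labAt : ∀ {y} → InS t u y → ∃ λ w → labAt t u w ≡ y
    InS⇒labAt (((.u , j) , u<j) , inj₁ refl , refl) = j , at-j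
      where
      at-j : labAt t u j ≡ label t ((u , j) , u<j)
      at-j with Finₚ.<-cmp u j
      ... | tri< u<j′ _ _ = cong (λ lt → label t ((u , j) , lt)) (Finₚ.<-irrelevant u<j′ u<j)
      ... | tri≈ _ u≡j _  = contradiction u<j (Finₚ.<-irrefl u≡j)
      ... | tri> _ _ j<u  = contradiction j<u (Finₚ.<-asym u<j)
    InS⇒labAt (((i , .u) , i<u) , inj₂ refl , refl) = i , at-i
      where
      at-i : labAt t u i ≡ label t ((i , u) , i<u)
      at-i with Finₚ.<-cmp u i
      ... | tri< u<i _ _  = contradiction u<i (Finₚ.<-asym i<u)
      ... | tri≈ _ u≡i _  = contradiction i<u (Finₚ.<-irrefl (sym u≡i))
      ... | tri> _ _ i<u′ = cong (λ lt → label t ((i , u) , lt)) (Finₚ.<-irrelevant i<u′ i<u)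

  module Vertex {n : ℕ} (t : Labeling n) (u : Fin n) {m ℓ p : ℕ} (type : STypeAt m ℓ p t u) where

    private
      N : ℕ
      N = ε n
      as : List AP
      as = proj₁ type
      fewer-than-m : length as ≤ m
      fewer-than-m = proj₁ (proj₂ type)
      pairwise-disjoint : AllPairs Disjoint as
      pairwise-disjoint = proj₁ (proj₂ (proj₂ type))
      inside-S : All (Inside (InS t u)) as
      inside-S = All.map proj₁ (proj₁ (proj₂ (proj₂ (proj₂ type))))
      long-enough : ℓ ≤ sum (map apLen as)
      long-enough = proj₂ (proj₂ (proj₂ (proj₂ type)))

    -- u itself contributes to weight 0 (labAt t u u ≡ 0), so the weights on [1, N] sum to less than n.
    weight : ℕ → ℕ
    weight y = fibre (labAt t u) y (allFin n)

    vertex-sum : ∀ (h : ℕ → ℕ) → h 0 ≡ 0 →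
                 sum (map (h ∘ labAt t u) (allFin n)) ≡ sumFrom 1 N (λ y → weight y * h y)
    vertex-sum h h0≡0 = begin
      sum (map (h ∘ labAt t u) (allFin n))
        ≡⟨ sum-by-fibres N (labAt t u) h (labAt≤ε t u) (allFin n) ⟩
      weight 0 * h 0 + Σweighted
        ≡⟨ cong (_+ Σweighted) (trans (cong (weight 0 *_) h0≡0) (*-zeroʳ (weight 0))) ⟩
      Σweighted ∎
      where
      open ≡-Reasoning
      Σweighted : ℕ
      Σweighted = sumFrom 1 N (λ y → weight y * h y)

    total-weight<n : sumFrom 1 N weight < n
    total-weight<n = begin-strict
      sumFrom 1 N weight                ≡⟨ +-identityˡ _ ⟨
      0 + sumFrom 1 N weight            <⟨ +-monoˡ-< _ self-counted ⟩
      weight 0 + sumFrom 1 N weight     ≡⟨ sum-fibres N (labAt t u) (labAt≤ε t u) (allFin n) ⟩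
      length (allFin n)                 ≡⟨ length-tabulate id ⟩
      n                                 ∎
      where
      open ≤-Reasoning
      self-counted : 0 < weight 0
      self-counted = subst (λ y → 1 ≤ weight y) (labAt-self t u) (fibre-∈ (labAt t u) (∈-allFin u))

    total-weight≤ : sumFrom 1 N weight ≤ n ∸ 1
    total-weight≤ = m+n≤o⇒m≤o∸n (sumFrom 1 N weight) (subst (_≤ n) (+-comm 1 _) total-weight<n)

    S-weighted : ∀ y → InS t u y → 1 ≤ weight y
    S-weighted y y∈S with InS⇒labAt t u y∈S
    ... | w , labAt≡y = subst (λ y → 1 ≤ weight y) labAt≡y (fibre-∈ (labAt t u) (∈-allFin w))

    open WeightedSums weight as (All.map (λ ins i i<k → InS⇒range t u (ins i i<k)) inside-S)
                                (χs≤ weight S-weighted pairwise-disjoint inside-S)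

    lengths≤weight : sum (map apLen as) ≤ sumFrom 1 N weight
    lengths≤weight = subst (sum (map apLen as) ≤_) (sym total-weight) (m≤m+n _ _)

    ℓ<n : ℓ < n
    ℓ<n = ≤-<-trans long-enough (≤-<-trans lengths≤weight total-weight<n)

    total-residual≤ : sumFrom 1 N residual ≤ n ∸ 1 ∸ ℓ
    total-residual≤ = begin
      sumFrom 1 N residual                                         ≡⟨ m+n∸m≡n (sum (map apLen as)) _ ⟨
      sum (map apLen as) + sumFrom 1 N residual ∸ sum (map apLen as) ≡⟨ cong (_∸ sum (map apLen as)) total-weight ⟨
      sumFrom 1 N weight ∸ sum (map apLen as)                      ≤⟨ ∸-mono total-weight≤ long-enough ⟩
      n ∸ 1 ∸ ℓ                                                    ∎
      where open ≤-Reasoning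

    drift≤ : ∀ {θt} → IsPSwap p t θt → ∣ s θt u - s t u ∣ ≤ m * (p * p) + p * (n ∸ 1 ∸ ℓ)
    drift≤ {θt} swap = m≤n+o⇒n≤m+o⇒∣m-n∣≤o
      (via-weights s-θt s-t (perturbation π id (block-upper σ) π-up))
      (via-weights s-t s-θt (perturbation id π (block-lower σ) π-down))
      where
      σ : BoundedPerm N p
      σ = relabelling t θt swap
      open BoundedPerm σ
      s-t : s t u ≡ sumFrom 1 N (λ y → weight y * y)
      s-t = vertex-sum id refl
      s-θt : s θt u ≡ sumFrom 1 N (λ y → weight y * π y)
      s-θt = trans (cong sum (map-cong (labAt-relabel t θt u) (allFin n))) (vertex-sum π refl)
      via-weights : ∀ {x y x′ y′} → x ≡ x′ → y ≡ y′ →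
                    x′ ≤ y′ + (length as * (p * p) + p * sumFrom 1 N residual) →
                    x ≤ y + (m * (p * p) + p * (n ∸ 1 ∸ ℓ))
      via-weights {y = y} refl refl x′≤ =
        ≤-trans x′≤ (+-monoʳ-≤ y (+-mono-≤ (*-monoˡ-≤ (p * p) fewer-than-m) (*-monoʳ-≤ p total-residual≤)))

open import Data.Integer using (ℤ; +_; _+_; _-_; _*_)
import Data.Integer as Z
import Data.Integer.Properties as ℤ
open import Data.Integer.Tactic.RingSolver using (solve-∀)

+m-+n≡+[m∸n] : ∀ {m n} → n ≤ m → + m - + n ≡ + (m ∸ n)
+m-+n≡+[m∸n] {m} {n} n≤m = trans (ℤ.m-n≡m⊖n m n) (ℤ.⊖-≥ n≤m)

+n-+ℓ-1≡+[n∸1∸ℓ] : ∀ {n ℓ} → ℓ < n → + n - + ℓ - + 1 ≡ + (n ∸ 1 ∸ ℓ)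
+n-+ℓ-1≡+[n∸1∸ℓ] {n} {ℓ} ℓ<n = begin
  + n - + ℓ - + 1          ≡⟨ cong (_- + 1) (+m-+n≡+[m∸n] (<⇒≤ ℓ<n)) ⟩
  + (n ∸ ℓ) - + 1        ≡⟨ +m-+n≡+[m∸n] (m<n⇒0<n∸m ℓ<n) ⟩
  + (n ∸ ℓ ∸ 1)        ≡⟨ cong +_ (∸-+-assoc n ℓ 1) ⟩
  + (n ∸ (ℓ ℕ.+ 1))      ≡⟨ cong (λ k → + (n ∸ k)) (+-comm ℓ 1) ⟩
  + (n ∸ (1 ℕ.+ ℓ))      ≡⟨ cong +_ (∸-+-assoc n 1 ℓ) ⟨
  + (n ∸ 1 ∸ ℓ)        ∎
  where open ≡-Reasoning

+-twice-drift : ∀ x m p b → let d = m ℕ.* (p ℕ.* p) ℕ.+ p ℕ.* b in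
                + (x ℕ.+ (d ℕ.+ d)) ≡ + x + (+ 2) * (+ m) * (+ p) * (+ p) + (+ 2) * (+ p) * (+ b)
+-twice-drift x m p b = trans (trans (ℤ.pos-+ x _) (cong (_+_ (+ x)) (trans (ℤ.pos-+ d d) (cong₂ _+_ +d +d))))
                              (twice (+ x) (+ m) (+ p) (+ b))
  where
  twice : ∀ x m p b → x + ((m * (p * p) + p * b) + (m * (p * p) + p * b)) ≡ x + (+ 2) * m * p * p + (+ 2) * p * b
  twice = solve-∀
  d : ℕ
  d = m ℕ.* (p ℕ.* p) ℕ.+ p ℕ.* b
  +d : + d ≡ + m * (+ p * + p) + + p * + b
  +d = trans (ℤ.pos-+ (m ℕ.* (p ℕ.* p)) (p ℕ.* b))
             (cong₂ _+_ (trans (ℤ.pos-* m (p ℕ.* p)) (cong (_*_ (+ m)) (ℤ.pos-* p p))) (ℤ.pos-* p b))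

-- The bound holds without the positivity hypotheses and for u ≡ v.
lemma5p8 : ∀ (n m p ℓ : ℕ) → 1 ≤ m → 1 ≤ p → 1 ≤ ℓ →
    (t : Labeling n) → OfType m ℓ p t →
    (u v : Fin n) → u ≢ v →
    (θt : Labeling n) → IsPSwap p t θt →
    (+ ∣ s θt u - s θt v ∣) Z.≤
      (+ ∣ s t u - s t v ∣) + (+ 2) * (+ m) * (+ p) * (+ p)
        + (+ 2) * (+ p) * ((+ n) - (+ ℓ) - (+ 1))
lemma5p8 n m p ℓ _ _ _ t type u v _ θt swap = begin
  + ∣ s θt u - s θt v ∣
    ≤⟨ Z.+≤+ (∣-∣-drift {s t u} {s t v} {s θt u} {s θt v} (drift u) (drift v)) ⟩
  + (∣ s t u - s t v ∣ ℕ.+ (d ℕ.+ d))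
    ≡⟨ +-twice-drift ∣ s t u - s t v ∣ m p (n ∸ 1 ∸ ℓ) ⟩
  bound (+ (n ∸ 1 ∸ ℓ))
    ≡⟨ cong bound (+n-+ℓ-1≡+[n∸1∸ℓ] (Vertex.ℓ<n t u {m} {ℓ} {p} (type u))) ⟨
  bound ((+ n) - (+ ℓ) - (+ 1)) ∎
  where
  open ℤ.≤-Reasoning
  d : ℕ
  d = m ℕ.* (p ℕ.* p) ℕ.+ p ℕ.* (n ∸ 1 ∸ ℓ)
  drift : ∀ w → ∣ s θt w - s t w ∣ ≤ d
  drift w = Vertex.drift≤ t w {m} {ℓ} {p} (type w) swap
  bound : ℤ → ℤ
  bound b = (+ ∣ s t u - s t v ∣) + (+ 2) * (+ m) * (+ p) * (+ p) + (+ 2) * (+ p) * b
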